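{- For every integer $k\geq 2$, $\mathcal{S}_3(1,k)=\mathcal{S}_{3s}(1,k)=\mathbb{N}\setminus\{1\}$.
   Context: Let $V$ be a set of $v$ elements and let $k,t$ be positive integers with $t<k<v$. A block is a $k$-subset of $V$. A $\mu$-way $(v,k,t)$ trade of volume $m$ ($\mu\geq 2$) is a family $T=\{T_1,\dots,T_\mu\}$ of $\mu$ pairwise disjoint collections of blocks (no block lies in two different $T_i$), each $T_i$ consisting of exactly $m$ blocks, such that for every $t$-subset $S$ of $V$, the number of blocks of $T_i$ containing $S$ is the same for all $i=1,\dots,\mu$. It is a $\mu$-way $(v,k,t)$ Steiner trade if moreover every $t$-subset of $V$ is contained in at most one block of each $T_i$. $\mathcal{S}_\mu(t,k)$ (resp. $\mathcal{S}_{\mu s}(t,k)$) denotes the set of all positive integers $m$ such that a $\mu$-way $(v,k,t)$ trade (resp. $\mu$-way $(v,k,t)$ Steiner trade) of volume $m$ exists for some $v$. Here $\mathbb{N}=\{1,2,3,\dots\}$. -}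

module Defs where

open import Data.Nat using (ℕ; _<_; _≤_)
open import Data.Fin using (Fin)
open import Data.Fin.Subset using (Subset; ∣_∣; _⊆_)
open import Data.Fin.Subset.Properties using (_⊆?_)
open import Data.List using (List; length; filter)
open import Data.List.Membership.Propositional using (_∈_)
open import Data.List.Relation.Unary.Unique.Propositional using (Unique)
open import Data.Product using (Σ; _×_; ∃)
open import Relation.Binary.PropositionalEquality using (_≡_)
open import Relation.Nullary using (¬_)

count : ∀ {v} → Subset v → List (Subset v) → ℕ
count S C = length (filter (S ⊆?_) C)

record IsTrade (μ v k t m : ℕ) (T : Fin μ → List (Subset v)) : Set where
  field
    blocks   : ∀ i {B} → B ∈ T i → ∣ B ∣ ≡ k
    distinct : ∀ i → Unique (T i)
    volume   : ∀ i → length (T i) ≡ m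
    disjoint : ∀ i j {B} → ¬ (i ≡ j) → B ∈ T i → ¬ (B ∈ T j)
    balanced : ∀ (S : Subset v) → ∣ S ∣ ≡ t → ∀ i j → count S (T i) ≡ count S (T j)

record IsSteinerTrade (μ v k t m : ℕ) (T : Fin μ → List (Subset v)) : Set where
  field
    trade   : IsTrade μ v k t m T
    steiner : ∀ (S : Subset v) → ∣ S ∣ ≡ t → ∀ i → count S (T i) ≤ 1

InS : (μ t k m : ℕ) → Set
InS μ t k m = (1 ≤ m) × ∃ λ v → (t < k) × (k < v) ×
  Σ (Fin μ → List (Subset v)) (IsTrade μ v k t m)

InSs : (μ t k m : ℕ) → Set
InSs μ t k m = (1 ≤ m) × ∃ λ v → (t < k) × (k < v) ×
  Σ (Fin μ → List (Subset v)) (IsSteinerTrade μ v k t m)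

-- A trade of volume 1 consists of single blocks, and balancing on points forces them to be
-- equal, contradicting disjointness; hence m ≥ 2.  Conversely, if each collection is a
-- resolution of the point set (every point in exactly one block) then every point count is 1,
-- so three pairwise disjoint resolutions into m blocks of size k form a Steiner trade.
-- For m ≥ 3 arrange k·m points in k columns of m, let the blocks be the transversals
-- {(c, π_c r)}, and let the three collections differ only by the powers ρ⁰, ρ¹, ρ² of a
-- cyclic shift ρ in the first column.  For m = 2 use complementary pairs {B, ∁B}, where on
-- four distinguished points B runs through the three edges of K₄ at a fixed vertex.
module Submission where

open import Defs
open import Data.Empty using (⊥-elim)
open import Data.Fin using (Fin; zero; suc; fromℕ; inject₁; lower₁; toℕ; combine)
open import Data.Fin.Permutation
  using (Permutation′; permutation; _⟨$⟩ʳ_; _⟨$⟩ˡ_; inverseʳ; inverseˡ; _∘ₚ_) renaming (id to idₚ)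
open import Data.Fin.Properties
  using (suc-injective; combine-surjective; fromℕ≢inject₁; inject₁-injective; inject₁-lower₁
        ; toℕ-fromℕ; toℕ-injective; toℕ-inject₁)
open import Data.Fin.Subset using (Subset; inside; outside; _∈_; _⊆_; ⁅_⁆; ∣_∣; ∁; ⊤; ⊥)
open import Data.Fin.Subset.Properties
  using (_⊆?_; _∈?_; x∈⁅x⁆; x∈⁅y⁆⇒x≡y; x∈⁅y⁆⇔x≡y; ∣⁅x⁆∣≡1; ∣⊤∣≡n; ∣⊥∣≡0; ∣∁p∣≡n∸∣p∣
        ; x∈p⇒x∉∁p; x∉p⇒x∈∁p; ⊆-antisym)
open import Data.List using (List; []; _∷_; length; filter; tabulate)
open import Data.List.Membership.Propositional.Properties using (∈-tabulate⁻)
open import Data.List.Properties using (filter-accept; filter-reject; filter-none; length-tabulate)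
open import Data.List.Relation.Unary.All using (All)
open import Data.List.Relation.Unary.All.Properties using (tabulate⁺)
open import Data.List.Relation.Unary.Any using (Any; here)
open import Data.List.Relation.Unary.Unique.Propositional.Properties
  using () renaming (tabulate⁺ to Unique-tabulate⁺)
open import Data.Nat using (ℕ; zero; suc; pred; _+_; _*_; _∸_; _≤_; z≤n; s≤s)
open import Data.Nat.Properties
  using (1+n≢n; _≟_; <⇒≢; m<n+m; m<m*n; m+n∸n≡m; m≤n⇒m≤1+n; m≤m+n; ≤-reflexive)
open import Data.Product using (_×_; _,_; ∃; proj₁; proj₂)
open import Data.Product.Properties using (,-injective)
open import Data.Vec using (Vec; []; _∷_; _++_; concat; map; lookup; replicate)
open import Data.Vec.Properties using (lookup-concat; lookup-map; []=⇒lookup; lookup⇒[]=)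
open import Function.Base using (_∘_)
open import Function.Bundles using (_⇔_; mk⇔; Equivalence)
open import Function.Construct.Composition using (_⇔-∘_)
open import Relation.Binary.PropositionalEquality
  using (_≡_; _≢_; refl; sym; trans; cong; cong₂; subst; subst₂; module ≡-Reasoning)
open import Relation.Nullary using (¬_; yes; no; contradiction)
open import Relation.Unary using (Pred; Decidable) renaming (∁ to ∁ᵘ)

open Equivalence using (to; from)

∣p++q∣≡∣p∣+∣q∣ : ∀ {m n} (p : Subset m) (q : Subset n) → ∣ p ++ q ∣ ≡ ∣ p ∣ + ∣ q ∣
∣p++q∣≡∣p∣+∣q∣ []            q = refl
∣p++q∣≡∣p∣+∣q∣ (outside ∷ p) q = ∣p++q∣≡∣p∣+∣q∣ p q
∣p++q∣≡∣p∣+∣q∣ (inside  ∷ p) q = cong suc (∣p++q∣≡∣p∣+∣q∣ p q)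

⁅x⁆⊆p⇔x∈p : ∀ {n} {x : Fin n} {p : Subset n} → (⁅ x ⁆ ⊆ p) ⇔ (x ∈ p)
⁅x⁆⊆p⇔x∈p {x = x} {p} = mk⇔
  (λ ⁅x⁆⊆p → ⁅x⁆⊆p (x∈⁅x⁆ x))
  (λ x∈p {y} y∈⁅x⁆ → subst (_∈ p) (sym (x∈⁅y⁆⇒x≡y x y∈⁅x⁆)) x∈p)

∣p∣≡0⇒p≡⊥ : ∀ {n} (p : Subset n) → ∣ p ∣ ≡ 0 → p ≡ ⊥
∣p∣≡0⇒p≡⊥ []            _  = refl
∣p∣≡0⇒p≡⊥ (outside ∷ p) eq = cong (outside ∷_) (∣p∣≡0⇒p≡⊥ p eq)

∣p∣≡1⇒p≡⁅x⁆ : ∀ {n} (p : Subset n) → ∣ p ∣ ≡ 1 → ∃ λ x → p ≡ ⁅ x ⁆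
∣p∣≡1⇒p≡⁅x⁆ (inside  ∷ p) eq = zero , cong (inside ∷_) (∣p∣≡0⇒p≡⊥ p (cong pred eq))
∣p∣≡1⇒p≡⁅x⁆ (outside ∷ p) eq with x , refl ← ∣p∣≡1⇒p≡⁅x⁆ p eq = suc x , refl

∈-cong-lookup : ∀ {m n} {x : Fin m} {y : Fin n} {p q} → lookup p x ≡ lookup q y → (x ∈ p) ⇔ (y ∈ q)
∈-cong-lookup {x = x} {y} {p} {q} eq = mk⇔
  (λ x∈p → lookup⇒[]= y q (trans (sym eq) ([]=⇒lookup x∈p)))
  (λ y∈q → lookup⇒[]= x p (trans eq ([]=⇒lookup y∈q)))

count[B]≡1⇔⊆ : ∀ {v} (S B : Subset v) → (count S (B ∷ []) ≡ 1) ⇔ (S ⊆ B)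
count[B]≡1⇔⊆ S B with S ⊆? B
... | yes S⊆B = mk⇔ (λ _ {x} → S⊆B {x}) (λ _ → refl)
... | no  S⊈B = mk⇔ (λ ()) (λ S⊆B → contradiction (λ {x} → S⊆B {x}) S⊈B)

point-balanced⇒⊆ : ∀ {v} {B B′ : Subset v} →
  (∀ x → count ⁅ x ⁆ (B ∷ []) ≡ count ⁅ x ⁆ (B′ ∷ [])) → B ⊆ B′
point-balanced⇒⊆ {B = B} {B′} balanced {x} x∈B =
  to ⁅x⁆⊆p⇔x∈p (to (count[B]≡1⇔⊆ ⁅ x ⁆ B′)
    (trans (sym (balanced x)) (from (count[B]≡1⇔⊆ ⁅ x ⁆ B) (from ⁅x⁆⊆p⇔x∈p x∈B))))

point-balanced⇒≡ : ∀ {v} {B B′ : Subset v} →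
  (∀ x → count ⁅ x ⁆ (B ∷ []) ≡ count ⁅ x ⁆ (B′ ∷ [])) → B ≡ B′
point-balanced⇒≡ balanced =
  ⊆-antisym (point-balanced⇒⊆ balanced) (point-balanced⇒⊆ (sym ∘ balanced))

length≡1⇒singleton : ∀ {A : Set} (xs : List A) → length xs ≡ 1 → ∃ λ x → xs ≡ x ∷ []
length≡1⇒singleton (x ∷ []) refl = x , refl

no-trade-of-volume-one : ∀ {μ v k T} {i j : Fin μ} → i ≢ j → ¬ IsTrade μ v k 1 1 T
no-trade-of-volume-one {T = T} {i} {j} i≢j trade
  with B , Tᵢ≡[B] ← length≡1⇒singleton (T i) (IsTrade.volume trade i)
     | B′ , Tⱼ≡[B′] ← length≡1⇒singleton (T j) (IsTrade.volume trade j) =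
  let open IsTrade trade
      B≡B′ : B ≡ B′
      B≡B′ = point-balanced⇒≡ λ x →
        subst₂ (λ C D → count ⁅ x ⁆ C ≡ count ⁅ x ⁆ D) Tᵢ≡[B] Tⱼ≡[B′]
               (balanced ⁅ x ⁆ (∣⁅x⁆∣≡1 x) i j)
  in disjoint i j i≢j (subst (Any (B ≡_)) (sym Tᵢ≡[B]) (here refl))
                      (subst (Any (B ≡_)) (sym Tⱼ≡[B′]) (here B≡B′))

InS⇒2≤m : ∀ {μ k m} → InS (suc (suc μ)) 1 k m → 2 ≤ m
InS⇒2≤m {m = zero} (() , _)
InS⇒2≤m {m = suc (suc _)} _ = s≤s (s≤s z≤n)
InS⇒2≤m {m = suc zero} (_ , _ , _ , _ , _ , trade) =
  ⊥-elim (no-trade-of-volume-one {i = zero} {j = suc zero} (λ ()) trade)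

module _ {a p} {A : Set a} {P : Pred A p} (P? : Decidable P) where
  open ≡-Reasoning

  filter-tabulate-unique : ∀ {n} (f : Fin n → A) (z : Fin n) →
    (∀ r → P (f r) ⇔ (r ≡ z)) → length (filter P? (tabulate f)) ≡ 1
  filter-tabulate-unique f zero unique = begin
    length (filter P? (f zero ∷ tabulate (f ∘ suc)))  ≡⟨ cong length (filter-accept P? (from (unique zero) refl)) ⟩
    suc (length (filter P? (tabulate (f ∘ suc))))     ≡⟨ cong (suc ∘ length) (filter-none P? none) ⟩
    1                                                  ∎
    where
    none : All (∁ᵘ P) (tabulate (f ∘ suc))
    none = tabulate⁺ {f = f ∘ suc} (λ r → (λ ()) ∘ to (unique (suc r)))
  filter-tabulate-unique f (suc z) unique = begin
    length (filter P? (f zero ∷ tabulate (f ∘ suc)))  ≡⟨ cong length (filter-reject P? ((λ ()) ∘ to (unique zero))) ⟩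
    length (filter P? (tabulate (f ∘ suc)))           ≡⟨ filter-tabulate-unique (f ∘ suc) z unique′ ⟩
    1                                                  ∎
    where
    unique′ : ∀ r → P (f (suc r)) ⇔ (r ≡ z)
    unique′ r = mk⇔ (suc-injective ∘ to (unique (suc r))) (from (unique (suc r)) ∘ cong suc)

tabulated-parallel-classes⇒SteinerTrade : ∀ {μ v k m} (f : Fin μ → Fin m → Subset v) →
  (∀ i r → ∣ f i r ∣ ≡ k) →
  (∀ {i i′ r r′} → f i r ≡ f i′ r′ → i ≡ i′ × r ≡ r′) →
  (∀ i x → count ⁅ x ⁆ (tabulate (f i)) ≡ 1) →
  IsSteinerTrade μ v k 1 m (λ i → tabulate (f i))
tabulated-parallel-classes⇒SteinerTrade f size injective covers = record
  { trade = record
    { blocks   = λ i B∈Tᵢ → let r , B≡fᵢr = ∈-tabulate⁻ B∈Tᵢ in trans (cong ∣_∣ B≡fᵢr) (size i r)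
    ; distinct = λ i → Unique-tabulate⁺ (proj₂ ∘ injective)
    ; volume   = λ i → length-tabulate (f i)
    ; disjoint = λ i j i≢j B∈Tᵢ B∈Tⱼ →
        let r , B≡fᵢr = ∈-tabulate⁻ B∈Tᵢ
            r′ , B≡fⱼr′ = ∈-tabulate⁻ B∈Tⱼ
        in i≢j (proj₁ (injective (trans (sym B≡fᵢr) B≡fⱼr′)))
    ; balanced = λ S ∣S∣≡1 i j → trans (count≡1 S ∣S∣≡1 i) (sym (count≡1 S ∣S∣≡1 j))
    }
  ; steiner = λ S ∣S∣≡1 i → ≤-reflexive (count≡1 S ∣S∣≡1 i)
  }
  where
  count≡1 : ∀ S → ∣ S ∣ ≡ 1 → ∀ i → count S (tabulate (f i)) ≡ 1
  count≡1 S ∣S∣≡1 i with x , refl ← ∣p∣≡1⇒p≡⁅x⁆ S ∣S∣≡1 = covers i x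

y≡π⟨$⟩ʳr⇔r≡π⟨$⟩ˡy : ∀ {m} (π : Permutation′ m) {r y} → (y ≡ π ⟨$⟩ʳ r) ⇔ (r ≡ π ⟨$⟩ˡ y)
y≡π⟨$⟩ʳr⇔r≡π⟨$⟩ˡy π = mk⇔
  (λ y≡πr → trans (sym (inverseˡ π)) (cong (π ⟨$⟩ˡ_) (sym y≡πr)))
  (λ r≡π⁻¹y → trans (sym (inverseʳ π)) (cong (π ⟨$⟩ʳ_) (sym r≡π⁻¹y)))

-- Point combine c y is the y-th point of column c; block r meets column c in π_c r.
transversal : ∀ {k m} → Vec (Permutation′ m) k → Fin m → Subset (k * m)
transversal σ r = concat (map (λ π → ⁅ π ⟨$⟩ʳ r ⁆) σ)

∣transversal∣ : ∀ {k m} (σ : Vec (Permutation′ m) k) r → ∣ transversal σ r ∣ ≡ k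
∣transversal∣ []      r = refl
∣transversal∣ (π ∷ σ) r = trans (∣p++q∣≡∣p∣+∣q∣ ⁅ π ⟨$⟩ʳ r ⁆ (transversal σ r))
                                (cong₂ _+_ (∣⁅x⁆∣≡1 (π ⟨$⟩ʳ r)) (∣transversal∣ σ r))

combine∈transversal⇔ : ∀ {k m} (σ : Vec (Permutation′ m) k) c y r →
  (combine c y ∈ transversal σ r) ⇔ (y ≡ lookup σ c ⟨$⟩ʳ r)
combine∈transversal⇔ σ c y r =
  x∈⁅y⁆⇔x≡y ⇔-∘ ∈-cong-lookup (trans (lookup-concat (map (λ π → ⁅ π ⟨$⟩ʳ r ⁆) σ) c y)
                                      (cong (λ p → lookup p y) (lookup-map c (λ π → ⁅ π ⟨$⟩ʳ r ⁆) σ)))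

transversal-≡⇒columns-≡ : ∀ {k m} {σ τ : Vec (Permutation′ m) k} {r r′} →
  transversal σ r ≡ transversal τ r′ → ∀ c → lookup σ c ⟨$⟩ʳ r ≡ lookup τ c ⟨$⟩ʳ r′
transversal-≡⇒columns-≡ {σ = σ} {τ} {r} {r′} eq c =
  to (combine∈transversal⇔ τ c _ r′)
     (subst (combine c (lookup σ c ⟨$⟩ʳ r) ∈_) eq (from (combine∈transversal⇔ σ c _ r) refl))

transversals-cover-once : ∀ {k m} (σ : Vec (Permutation′ m) k) x →
  count ⁅ x ⁆ (tabulate (transversal σ)) ≡ 1
transversals-cover-once {k} {m} σ x with c , y , refl ← combine-surjective {k} {m} x =
  filter-tabulate-unique (⁅ combine c y ⁆ ⊆?_) (transversal σ) (lookup σ c ⟨$⟩ˡ y)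
    (λ r → y≡π⟨$⟩ʳr⇔r≡π⟨$⟩ˡy (lookup σ c) ⇔-∘ (combine∈transversal⇔ σ c y r ⇔-∘ ⁅x⁆⊆p⇔x∈p))

rotate : ∀ {n} → Fin (suc n) → Fin (suc n)
rotate zero    = fromℕ _
rotate (suc i) = inject₁ i

rotate-injective : ∀ {n} {i j : Fin (suc n)} → rotate i ≡ rotate j → i ≡ j
rotate-injective {i = zero}  {zero}  _  = refl
rotate-injective {i = zero}  {suc j} eq = ⊥-elim (fromℕ≢inject₁ eq)
rotate-injective {i = suc i} {zero}  eq = ⊥-elim (fromℕ≢inject₁ (sym eq))
rotate-injective {i = suc i} {suc j} eq = cong suc (inject₁-injective eq)

unrotate : ∀ {n} → Fin (suc n) → Fin (suc n)
unrotate {n} i with n ≟ toℕ i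
... | yes _   = zero
... | no  n≢i = suc (lower₁ i n≢i)

rotate-unrotate : ∀ {n} (i : Fin (suc n)) → rotate (unrotate i) ≡ i
rotate-unrotate {n} i with n ≟ toℕ i
... | yes n≡i = toℕ-injective (trans (toℕ-fromℕ n) n≡i)
... | no  n≢i = inject₁-lower₁ i n≢i

rotation : ∀ {n} → Permutation′ (suc n)
rotation = permutation rotate unrotate rotate-unrotate
  (λ i → rotate-injective (rotate-unrotate (rotate i)))

rotation-fixedPointFree : ∀ {n} (i : Fin (suc (suc n))) → rotation ⟨$⟩ʳ i ≢ i
rotation-fixedPointFree zero ()
rotation-fixedPointFree (suc i) eq =
  1+n≢n (sym (trans (sym (toℕ-inject₁ i)) (cong toℕ eq)))

rotation²-fixedPointFree : ∀ {n} (i : Fin (suc (suc (suc n)))) → (rotation ∘ₚ rotation) ⟨$⟩ʳ i ≢ i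
rotation²-fixedPointFree zero ()
rotation²-fixedPointFree (suc zero) ()
rotation²-fixedPointFree (suc (suc i)) eq =
  <⇒≢ (m<n+m (toℕ i) (s≤s z≤n))
    (trans (sym (trans (toℕ-inject₁ (inject₁ i)) (toℕ-inject₁ i))) (cong toℕ eq))

rotationPower : ∀ {n} → Fin 3 → Permutation′ (suc n)
rotationPower zero             = idₚ
rotationPower (suc zero)       = rotation
rotationPower (suc (suc zero)) = rotation ∘ₚ rotation

rotationPower-injectiveAt : ∀ {n} {i j : Fin 3} (r : Fin (3 + n)) →
  rotationPower i ⟨$⟩ʳ r ≡ rotationPower j ⟨$⟩ʳ r → i ≡ j
rotationPower-injectiveAt {i = zero} {zero} r eq = refl
rotationPower-injectiveAt {i = suc zero} {suc zero} r eq = refl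
rotationPower-injectiveAt {i = suc (suc zero)} {suc (suc zero)} r eq = refl
rotationPower-injectiveAt {i = zero} {suc zero} r eq = ⊥-elim (rotation-fixedPointFree r (sym eq))
rotationPower-injectiveAt {i = suc zero} {zero} r eq = ⊥-elim (rotation-fixedPointFree r eq)
rotationPower-injectiveAt {i = zero} {suc (suc zero)} r eq = ⊥-elim (rotation²-fixedPointFree r (sym eq))
rotationPower-injectiveAt {i = suc (suc zero)} {zero} r eq = ⊥-elim (rotation²-fixedPointFree r eq)
rotationPower-injectiveAt {i = suc zero} {suc (suc zero)} r eq =
  ⊥-elim (rotation-fixedPointFree r (sym (rotate-injective eq)))
rotationPower-injectiveAt {i = suc (suc zero)} {suc zero} r eq =
  ⊥-elim (rotation-fixedPointFree r (rotate-injective eq))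

module _ (j n : ℕ) where

  shifted : Fin 3 → Vec (Permutation′ (3 + n)) (2 + j)
  shifted i = rotationPower i ∷ replicate _ idₚ

  shifted-transversal-injective : ∀ {i i′ : Fin 3} {r r′ : Fin (3 + n)} →
    transversal (shifted i) r ≡ transversal (shifted i′) r′ → i ≡ i′ × r ≡ r′
  shifted-transversal-injective {i} {i′} {r} {r′} eq =
    rotationPower-injectiveAt r
      (trans (column zero) (cong (rotationPower i′ ⟨$⟩ʳ_) (sym (column (suc zero))))) ,
    column (suc zero)
    where
    column : ∀ c → lookup (shifted i) c ⟨$⟩ʳ r ≡ lookup (shifted i′) c ⟨$⟩ʳ r′
    column = transversal-≡⇒columns-≡ eq

  InSs-volume≥3 : InSs 3 1 (2 + j) (3 + n)
  InSs-volume≥3 =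
    s≤s z≤n , (2 + j) * (3 + n) , s≤s (s≤s z≤n) , m<m*n (2 + j) (3 + n) (s≤s (s≤s z≤n)) , _ ,
    tabulated-parallel-classes⇒SteinerTrade (λ i → transversal (shifted i))
      (λ i → ∣transversal∣ (shifted i)) shifted-transversal-injective
      (λ i → transversals-cover-once (shifted i))

count-complementaryPair : ∀ {v} (x : Fin v) (B : Subset v) → count ⁅ x ⁆ (B ∷ ∁ B ∷ []) ≡ 1
count-complementaryPair x B with x ∈? B
... | yes x∈B = cong length (trans (filter-accept (⁅ x ⁆ ⊆?_) (from ⁅x⁆⊆p⇔x∈p x∈B))
  (cong (B ∷_) (filter-reject (⁅ x ⁆ ⊆?_) (x∈p⇒x∉∁p x∈B ∘ to ⁅x⁆⊆p⇔x∈p))))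
... | no  x∉B = cong length (trans (filter-reject (⁅ x ⁆ ⊆?_) (x∉B ∘ to ⁅x⁆⊆p⇔x∈p))
  (filter-accept (⁅ x ⁆ ⊆?_) (from ⁅x⁆⊆p⇔x∈p (x∉p⇒x∈∁p x∉B))))

perfectMatching : Fin 3 → Subset 4
perfectMatching zero             = inside ∷ inside  ∷ outside ∷ outside ∷ []
perfectMatching (suc zero)       = inside ∷ outside ∷ inside  ∷ outside ∷ []
perfectMatching (suc (suc zero)) = inside ∷ outside ∷ outside ∷ inside  ∷ []

∣perfectMatching∣ : ∀ i → ∣ perfectMatching i ∣ ≡ 2
∣perfectMatching∣ zero             = refl
∣perfectMatching∣ (suc zero)       = refl
∣perfectMatching∣ (suc (suc zero)) = refl

module _ (j : ℕ) where

  halfBlock : Fin 3 → Subset (4 + (j + j))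
  halfBlock i = perfectMatching i ++ (⊥ {n = j} ++ ⊤ {n = j})

  complementaryPair : Fin 3 → Fin 2 → Subset (4 + (j + j))
  complementaryPair i zero       = halfBlock i
  complementaryPair i (suc zero) = ∁ (halfBlock i)

  -- On the first four points the blocks are the six distinct edges of K₄,
  -- so these points determine (i , r).
  pairIndex : Subset (4 + (j + j)) → Fin 3 × Fin 2
  pairIndex (inside  ∷ inside  ∷ _)           = zero , zero
  pairIndex (inside  ∷ outside ∷ inside  ∷ _) = suc zero , zero
  pairIndex (inside  ∷ outside ∷ outside ∷ _) = suc (suc zero) , zero
  pairIndex (outside ∷ outside ∷ _)           = zero , suc zero
  pairIndex (outside ∷ inside  ∷ outside ∷ _) = suc zero , suc zero
  pairIndex (outside ∷ inside  ∷ inside  ∷ _) = suc (suc zero) , suc zero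

  pairIndex-complementaryPair : ∀ i r → pairIndex (complementaryPair i r) ≡ (i , r)
  pairIndex-complementaryPair zero             zero       = refl
  pairIndex-complementaryPair zero             (suc zero) = refl
  pairIndex-complementaryPair (suc zero)       zero       = refl
  pairIndex-complementaryPair (suc zero)       (suc zero) = refl
  pairIndex-complementaryPair (suc (suc zero)) zero       = refl
  pairIndex-complementaryPair (suc (suc zero)) (suc zero) = refl

  complementaryPair-injective : ∀ {i i′ r r′} →
    complementaryPair i r ≡ complementaryPair i′ r′ → i ≡ i′ × r ≡ r′
  complementaryPair-injective {i} {i′} {r} {r′} eq = ,-injective
    (trans (sym (pairIndex-complementaryPair i r))
           (trans (cong pairIndex eq) (pairIndex-complementaryPair i′ r′)))

  ∣halfBlock∣ : ∀ i → ∣ halfBlock i ∣ ≡ 2 + j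
  ∣halfBlock∣ i = begin
    ∣ halfBlock i ∣                            ≡⟨ ∣p++q∣≡∣p∣+∣q∣ (perfectMatching i) (⊥ {n = j} ++ ⊤) ⟩
    ∣ perfectMatching i ∣ + ∣ ⊥ {n = j} ++ ⊤ ∣ ≡⟨ cong₂ _+_ (∣perfectMatching∣ i) (∣p++q∣≡∣p∣+∣q∣ (⊥ {n = j}) ⊤) ⟩
    2 + (∣ ⊥ {n = j} ∣ + ∣ ⊤ {n = j} ∣)        ≡⟨ cong₂ (λ a b → 2 + (a + b)) (∣⊥∣≡0 j) (∣⊤∣≡n j) ⟩
    2 + j                                       ∎
    where open ≡-Reasoning

  ∣complementaryPair∣ : ∀ i r → ∣ complementaryPair i r ∣ ≡ 2 + j
  ∣complementaryPair∣ i zero       = ∣halfBlock∣ i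
  ∣complementaryPair∣ i (suc zero) = begin
    ∣ ∁ (halfBlock i) ∣          ≡⟨ ∣∁p∣≡n∸∣p∣ (halfBlock i) ⟩
    4 + (j + j) ∸ ∣ halfBlock i ∣ ≡⟨ cong (4 + (j + j) ∸_) (∣halfBlock∣ i) ⟩
    4 + (j + j) ∸ (2 + j)         ≡⟨ m+n∸n≡m (2 + j) j ⟩
    2 + j                         ∎
    where open ≡-Reasoning

  InSs-volume2 : InSs 3 1 (2 + j) 2
  InSs-volume2 =
    s≤s z≤n , 4 + (j + j) , s≤s (s≤s z≤n) , s≤s (s≤s (s≤s (m≤n⇒m≤1+n (m≤m+n j j)))) , _ ,
    tabulated-parallel-classes⇒SteinerTrade complementaryPair
      ∣complementaryPair∣ complementaryPair-injective
      (λ i x → count-complementaryPair x (halfBlock i))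

InSs⇒InS : ∀ {μ t k m} → InSs μ t k m → InS μ t k m
InSs⇒InS (1≤m , v , t<k , k<v , T , steiner) = 1≤m , v , t<k , k<v , T , IsSteinerTrade.trade steiner

2≤m⇒InSs-3-1 : ∀ {k m} → 2 ≤ k → 2 ≤ m → InSs 3 1 k m
2≤m⇒InSs-3-1 {suc (suc j)} {suc (suc zero)}    (s≤s (s≤s z≤n)) (s≤s (s≤s z≤n)) = InSs-volume2 j
2≤m⇒InSs-3-1 {suc (suc j)} {suc (suc (suc n))} (s≤s (s≤s z≤n)) (s≤s (s≤s z≤n)) = InSs-volume≥3 j n

mainTheorem1 : ∀ (k : ℕ) → 2 ≤ k → ∀ (m : ℕ) →
    (InS 3 1 k m ⇔ (2 ≤ m)) × (InSs 3 1 k m ⇔ (2 ≤ m))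
mainTheorem1 k 2≤k m =
  mk⇔ InS⇒2≤m (InSs⇒InS ∘ 2≤m⇒InSs-3-1 2≤k) ,
  mk⇔ (InS⇒2≤m ∘ InSs⇒InS) (2≤m⇒InSs-3-1 2≤k)
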